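{- Let $G=(V,E)$ be a directed graph, $s\neq t$ vertices, $k$ a positive integer and $(u,v)\in E$. Suppose that for all integers $0\le k_f,k_b\le k-1$ with $k_f+1+k_b\le k$, either (1) $EV^\ast_{k_f}(s,u)$ or $EV^\ast_{k_b}(v,t)$ does not exist, or (2) $EV^\ast_{k_f}(s,u)\cap EV^\ast_{k_b}(v,t)\neq\emptyset$. Then $(u,v)$ is not an edge of $SPG_k(s,t)$.
   Context: Let $G=(V,E)$ be a directed graph. A path from $x$ to $y$ is a vertex sequence $x=v_0,\ldots,v_l=y$ with $(v_{i-1},v_i)\in E$; its length is $l$ (the trivial path of length $0$ from $x$ to $x$ is allowed); $V(p)$ is its vertex set. A path is simple if its vertices are pairwise distinct. $P_l^\ast(x,y)$ is the set of simple paths from $x$ to $y$ of length at most $l$. $SPG_k(s,t)$ is the subgraph of $G$ formed by the union of vertices and edges of all simple $s$-$t$ paths of length at most $k$. Essential vertices: for query vertices $s,t$, $EV_l^\ast(s,u)=\bigcap\{V(p): p\in P_l^\ast(s,u),\ t\notin V(p)\}$ and $EV_l^\ast(v,t)=\bigcap\{V(p): p\in P_l^\ast(v,t),\ s\notin V(p)\}$. $EV_l^\ast(s,u)$ exists iff there is at least one $p\in P_l^\ast(s,u)$ with $t\notin V(p)$ (similarly, $EV_l^\ast(v,t)$ exists iff some $p\in P_l^\ast(v,t)$ has $s\notin V(p)$). -}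

module Defs where

open import Level using (Level; _⊔_)
open import Data.Nat using (ℕ; zero; suc; _≤_)
open import Data.List using (List; []; _∷_)
open import Data.List.Membership.Propositional using (_∈_; _∉_)
open import Data.List.Relation.Unary.Unique.Propositional using (Unique)
open import Data.Product using (Σ; _×_; ∃)

module _ {a b : Level} {V : Set a} (E : V → V → Set b) where

  data Path : V → V → Set (a ⊔ b) where
    [_] : (x : V) → Path x x
    _∷_ : {x y z : V} → E x y → Path y z → Path x z

  verts : {x y : V} → Path x y → List V
  verts [ x ] = x ∷ []
  verts (_∷_ {x} e p) = x ∷ verts p

  len : {x y : V} → Path x y → ℕ
  len [ x ] = zero
  len (e ∷ p) = suc (len p)

  Simple : {x y : V} → Path x y → Set a
  Simple p = Unique (verts p)

  data HasEdge (u v : V) : {x y : V} → Path x y → Set (a ⊔ b) where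
    here  : {z : V} (e : E u v) (p : Path v z) → HasEdge u v (e ∷ p)
    there : {x y z : V} (e : E x y) {p : Path y z} → HasEdge u v p → HasEdge u v (e ∷ p)

  InPAvoid : ℕ → (x y z : V) → Path x y → Set a
  InPAvoid l x y z p = Simple p × len p ≤ l × z ∉ verts p

  -- EV*_l(x,y) w.r.t. forbidden vertex z exists: some p ∈ P*_l(x,y) with z ∉ V(p)
  EVExists : ℕ → (x y z : V) → Set (a ⊔ b)
  EVExists l x y z = Σ (Path x y) (InPAvoid l x y z)

  -- w ∈ EV*_l(x,y) w.r.t. forbidden vertex z: w lies on every such path
  InEV : ℕ → (x y z : V) → V → Set (a ⊔ b)
  InEV l x y z w = (p : Path x y) → InPAvoid l x y z p → w ∈ verts p

  -- (u,v) is an edge of SPG_k(s,t): it lies on a simple s-t path of length ≤ k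
  EdgeOfSPG : ℕ → (s t u v : V) → Set (a ⊔ b)
  EdgeOfSPG k s t u v = Σ (Path s t) λ p → Simple p × len p ≤ k × HasEdge u v p

{-# OPTIONS --safe #-}
module Submission where

open import Defs
open import Level using (Level; _⊔_)
open import Data.Nat using (ℕ; suc; _≤_; _+_; _∸_)
open import Data.Nat.Properties using (+-assoc; ≤-refl; m+n≤o⇒m≤o; m+n≤o⇒n≤o; m+n≤o⇒m≤o∸n; ∸-monoˡ-≤)
open import Data.Product using (Σ; _×_; _,_; proj₁; proj₂)
open import Data.Sum using (_⊎_; inj₁; inj₂)
open import Data.List using (List; []; _∷_; _++_)
open import Data.List.Membership.Propositional using (_∈_)
open import Data.List.Membership.Propositional.Properties using (∈-++⁺ʳ)
open import Data.List.Relation.Unary.Any using (here; there)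
open import Data.List.Relation.Unary.All using (lookup)
open import Data.List.Relation.Unary.All.Properties using (++⁻ˡ)
open import Data.List.Relation.Unary.AllPairs using ([]; _∷_)
open import Data.List.Relation.Unary.Unique.Propositional using (Unique)
open import Data.List.Relation.Binary.Disjoint.Propositional using (Disjoint)
open import Relation.Nullary using (¬_)
open import Relation.Binary.PropositionalEquality using (_≡_; _≢_; refl; sym; cong; subst)

-- A simple s-t path of length ≤ k through (u,v) splits into a simple s-u path q avoiding t
-- and a simple v-t path r avoiding s, vertex-disjoint, with len q + 1 + len r ≤ k.
-- The hypothesis for kf = len q and kb = len r then either denies that q or r exists,
-- or yields a vertex common to both.

Unique-++⁻ : ∀ {a} {A : Set a} (xs : List A) {ys : List A} →
             Unique (xs ++ ys) → Unique xs × Unique ys × Disjoint xs ys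
Unique-++⁻ []       ys! = [] , ys! , λ ()
Unique-++⁻ (x ∷ xs) (x∉xs++ys ∷ xs++ys!) with Unique-++⁻ xs xs++ys!
... | xs! , ys! , xs#ys = ++⁻ˡ xs x∉xs++ys ∷ xs! , ys! , x∷xs#ys
  where
    x∷xs#ys : Disjoint (x ∷ xs) _
    x∷xs#ys (here refl , x∈ys) = lookup x∉xs++ys (∈-++⁺ʳ xs x∈ys) refl
    x∷xs#ys (there v∈xs , v∈ys) = xs#ys (v∈xs , v∈ys)

m+suc[n]≤k⇒bounds : ∀ m n {k} → m + suc n ≤ k → m ≤ k ∸ 1 × n ≤ k ∸ 1 × m + 1 + n ≤ k
m+suc[n]≤k⇒bounds m n {k} m+suc[n]≤k =
  m+n≤o⇒m≤o∸n m (m+n≤o⇒m≤o (m + 1) m+1+n≤k) , ∸-monoˡ-≤ 1 (m+n≤o⇒n≤o m m+suc[n]≤k) , m+1+n≤k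
  where
    m+1+n≤k : m + 1 + n ≤ k
    m+1+n≤k = subst (_≤ k) (sym (+-assoc m 1 n)) m+suc[n]≤k

module _ {a b : Level} {V : Set a} (E : V → V → Set b) where

  head∈verts : {x y : V} (p : Path E x y) → x ∈ verts E p
  head∈verts [ x ]   = here refl
  head∈verts (e ∷ p) = here refl

  last∈verts : {x y : V} (p : Path E x y) → y ∈ verts E p
  last∈verts [ x ]   = here refl
  last∈verts (e ∷ p) = there (last∈verts p)

  record SplitAt (u v : V) {x y : V} (p : Path E x y) : Set (a ⊔ b) where
    field
      prefix      : Path E x u
      suffix      : Path E v y
      verts-split : verts E p ≡ verts E prefix ++ verts E suffix
      len-split   : len E p ≡ len E prefix + suc (len E suffix)

  splitAt : {u v x y : V} {p : Path E x y} → HasEdge E u v p → SplitAt u v p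
  splitAt (here e r) = record { prefix = [ _ ] ; suffix = r ; verts-split = refl ; len-split = refl }
  splitAt (there {x} e h) = record
    { prefix      = e ∷ prefix
    ; suffix      = suffix
    ; verts-split = cong (x ∷_) verts-split
    ; len-split   = cong suc len-split
    }
    where open SplitAt (splitAt h)

  simplePath-through-edge : {u v x y : V} {p : Path E x y} → Simple E p → HasEdge E u v p →
    Σ (Path E x u) λ q → Σ (Path E v y) λ r →
      InPAvoid E (len E q) x u y q × InPAvoid E (len E r) v y x r ×
      Disjoint (verts E q) (verts E r) × len E p ≡ len E q + suc (len E r)
  simplePath-through-edge p! h =
    prefix , suffix ,
    (prefix! , ≤-refl , λ y∈prefix → prefix#suffix (y∈prefix , last∈verts suffix)) ,
    (suffix! , ≤-refl , λ x∈suffix → prefix#suffix (head∈verts prefix , x∈suffix)) ,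
    prefix#suffix , len-split
    where
      open SplitAt (splitAt h)
      halves! : Unique (verts E prefix) × Unique (verts E suffix) × Disjoint (verts E prefix) (verts E suffix)
      halves! = Unique-++⁻ (verts E prefix) (subst Unique verts-split p!)
      prefix! = proj₁ halves!
      suffix! = proj₁ (proj₂ halves!)
      prefix#suffix = proj₂ (proj₂ halves!)

theorem4 : {a b : Level} {V : Set a} (E : V → V → Set b) (s t u v : V) (k : ℕ) →
    s ≢ t → 1 ≤ k → E u v →
    ((kf kb : ℕ) → kf ≤ k ∸ 1 → kb ≤ k ∸ 1 → kf + 1 + kb ≤ k →
      ((¬ EVExists E kf s u t) ⊎ (¬ EVExists E kb v t s))
      ⊎ Σ V (λ w → InEV E kf s u t w × InEV E kb v t s w)) →
    ¬ EdgeOfSPG E k s t u v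
theorem4 E s t u v k _ _ _ separated (p , p! , p≤k , through-uv)
  with simplePath-through-edge E p! through-uv
... | q , r , q-ok , r-ok , q#r , len-split
  with m+suc[n]≤k⇒bounds (len E q) (len E r) (subst (_≤ k) len-split p≤k)
... | kf≤ , kb≤ , kf+1+kb≤k
  with separated (len E q) (len E r) kf≤ kb≤ kf+1+kb≤k
... | inj₁ (inj₁ no-q) = no-q (q , q-ok)
... | inj₁ (inj₂ no-r) = no-r (r , r-ok)
... | inj₂ (w , w∈every-q , w∈every-r) = q#r (w∈every-q q q-ok , w∈every-r r r-ok)
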